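{- For instances of fixed order scheduling with deadlines in which the deadlines are non-increasing along the fixed order ($d_1\ge d_2\ge\cdots\ge d_n$), the first-fit algorithm is a $2$-approximation, i.e. $FF(I)\le 2\,OPT(I)$ for every such instance $I$.
   Context: Fixed order scheduling with deadlines: there are $n$ jobs $1,\dots,n$, job $j$ having processing time $p_j\in\mathbb{N}$, $p_j>0$, and deadline $d_j\in\mathbb{N}$ with $d_j\ge p_j$. All jobs are released at time $0$, and there are sufficiently many identical machines. Each machine processes its assigned jobs non-preemptively, without idle time, in increasing order of job index. A schedule is feasible if, for every job $j$, the total processing time of jobs $k\le j$ on the machine of $j$ is at most $d_j$. $OPT(I)$ is the minimum number of machines used (receiving at least one job) by a feasible schedule. The first-fit algorithm considers jobs in order $1,\dots,n$ and appends each job to the lowest-indexed open machine on which it would meet its deadline, opening a new machine if there is none; $FF(I)$ is the number of machines it opens. -}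

module Defs where

open import Data.Nat using (ℕ; zero; suc; _+_; _≤_; _≤?_)
open import Data.Fin using (Fin; toℕ)
open import Data.Fin.Properties using () renaming (_≟_ to _≟ᶠ_)
open import Data.Nat.Properties using (_≟_)
open import Data.List using (List; []; _∷_; length; map; filter; foldl; deduplicate)
open import Data.Nat.ListAction using (sum)
open import Data.Product using (_×_)
open import Relation.Nullary using (yes; no)
open import Relation.Nullary.Decidable using (_×-dec_)
open import Data.List using () renaming (allFin to allFinL)

-- An instance with n jobs: processing times p and deadlines d, indexed by Fin n
-- (the fixed order is the order of Fin n, i.e. increasing index).

Schedule : ℕ → Set
Schedule n = Fin n → ℕ

-- Completion time of job j under schedule σ: total processing time of the jobs
-- k ≤ j on the machine of j (machines process jobs in index order, no idle time).
completion : ∀ {n} → (Fin n → ℕ) → Schedule n → Fin n → ℕ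
completion {n} p σ j =
  sum (map p (filter (λ k → (toℕ k ≤? toℕ j) ×-dec (σ k ≟ σ j)) (allFinL n)))

Feasible : ∀ {n} → (p d : Fin n → ℕ) → Schedule n → Set
Feasible p d σ = ∀ j → completion p σ j ≤ d j

machinesUsed : ∀ {n} → Schedule n → ℕ
machinesUsed {n} σ = length (deduplicate _≟_ (map σ (allFinL n)))

-- The state is the list of loads of the open machines, in index order.
ffInsert : ℕ → ℕ → List ℕ → List ℕ
ffInsert p d [] = p ∷ []
ffInsert p d (l ∷ ls) with l + p ≤? d
... | yes _ = (l + p) ∷ ls
... | no _  = l ∷ ffInsert p d ls

ffLoads : ∀ {n} → (p d : Fin n → ℕ) → List ℕ
ffLoads {n} p d = foldl (λ ls j → ffInsert (p j) (d j) ls) [] (allFinL n)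

FF : ∀ {n} → (p d : Fin n → ℕ) → ℕ
FF p d = length (ffLoads p d)

{-# OPTIONS --safe #-}
module Submission where

-- First-fit's loads L carry the potential 2ΣL − (last load): filling a machine never lowers it,
-- and opening one for a job with deadline d raises it by more than d, because the job did not fit
-- on the previous last machine. Walk along the jobs up to the first prefix on which first-fit uses
-- at most 2b machines, b counting the machines of σ all of whose jobs lie in the prefix. Before
-- that, the potential is at least twice the work of those b machines plus 2b, plus D + 1 for each
-- first-fit machine beyond 2b + 1, D the current deadline: deadlines only decrease, and by
-- feasibility a machine of σ completed at a job with deadline D carries work at most D. At the
-- end of the job list every machine of σ is complete and the potential is at most twice the
-- total work, so the prefix exists. The later jobs that do not fit on the prefix's machines are
-- treated by first-fit as if they were alone and use only the other machines of σ, so induction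
-- applies to them.

open import Defs
open import Data.Nat using (ℕ; suc; _+_; _*_; _≤_; _<_; _≤?_; z≤n; s≤s; _≟_)
open import Data.Fin using (Fin; toℕ)
open import Data.Fin using () renaming (_≤_ to _≤ᶠ_)
open import Data.Nat.Properties
  using ( +-commutativeSemigroup; ≤-refl; ≤-trans; ≤-reflexive; ≤-antisym; ≤-pred; ≰⇒>; <⇒≤; n≤0⇒n≡0; m+1+n≢0
        ; m≤m+n; m≤n+m; +-monoʳ-≤; +-monoˡ-≤; +-mono-≤; *-monoʳ-≤; +-cancelˡ-≤; +-cancelʳ-≡
        ; +-assoc; +-suc; +-comm; +-identityʳ; *-identityˡ; *-distribˡ-+; *-zeroʳ
        ; module ≤-Reasoning )
open import Data.Nat.Induction using (<-wellFounded)
open import Data.Nat.Tactic.RingSolver using (solve-∀)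
open import Data.Nat.ListAction using (sum)
open import Algebra.Properties.CommutativeSemigroup +-commutativeSemigroup using (interchange; x∙yz≈y∙xz)
open import Data.Nat.ListAction.Properties using (sum-++)
open import Data.List using (List; []; _∷_; [_]; _++_; length; map; filter; foldl; allFin; deduplicate)
open import Data.List.Properties using (map-++; map-cong-local; filter-++; filter-accept; filter-reject; foldl-++; length-++; ++-assoc; ++-identityʳ)
open import Data.List.Relation.Unary.All as All using (All; []; _∷_)
import Data.List.Relation.Unary.All.Properties as All
open import Data.List.Relation.Unary.Any using (Any; here; there; any?)
import Data.List.Relation.Unary.Any.Properties as Any
open import Data.List.Relation.Unary.AllPairs as AllPairs using (AllPairs; []; _∷_)
import Data.List.Relation.Unary.AllPairs.Properties as AllPairsₚ
open import Data.List.Relation.Unary.Unique.Propositional using (Unique)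
open import Data.List.Relation.Unary.Unique.DecPropositional.Properties _≟_ using (deduplicate-!)
open import Data.List.Membership.Propositional using (_∈_)
open import Data.List.Membership.Propositional.Properties using (∈-map⁺; ∈-allFin; ∈-deduplicate⁺)
open import Data.List.Relation.Binary.Sublist.Propositional as Sublist using (_⊆_; minimum; ⊆-refl)
open import Data.List.Relation.Binary.Sublist.Propositional.Properties
  using (All-resp-⊆; Any-resp-⊆; length-mono-≤; ++⁺ʳ; ++⁺)
open import Data.Bool using (if_then_else_)
open import Data.Product using (_×_; _,_; proj₁; proj₂)
open import Data.Sum using (inj₁; inj₂)
open import Data.Empty using (⊥-elim)
open import Data.Unit using (⊤; tt)
open import Function using (_∘_; _on_)
open import Induction.WellFounded using (Acc; acc)
import Relation.Binary.Construct.On as On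
open import Relation.Nullary using (Dec; yes; no; ¬_; does; contradiction)
open import Relation.Nullary.Decidable using (¬?; _×-dec_; dec-true; dec-false)
open import Relation.Binary.PropositionalEquality
  using (_≡_; _≢_; refl; sym; trans; cong; cong₂; subst; subst₂; module ≡-Reasoning)

private
  variable
    A : Set
    P Q : Set

𝟙 : Dec P → ℕ
𝟙 P? = if does P? then 1 else 0

𝟙-yes : (P? : Dec P) → P → 𝟙 P? ≡ 1
𝟙-yes P? p rewrite dec-true P? p = refl

𝟙-no : (P? : Dec P) → ¬ P → 𝟙 P? ≡ 0
𝟙-no P? ¬p rewrite dec-false P? ¬p = refl

𝟙≤1 : (P? : Dec P) → 𝟙 P? ≤ 1
𝟙≤1 (yes _) = ≤-refl
𝟙≤1 (no _)  = z≤n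

𝟙-mono : (P? : Dec P) (Q? : Dec Q) → (P → Q) → 𝟙 P? ≤ 𝟙 Q?
𝟙-mono (yes p) Q? f = ≤-reflexive (sym (𝟙-yes Q? (f p)))
𝟙-mono (no _)  Q? f = z≤n

𝟙-cong : (P? : Dec P) (Q? : Dec Q) → (P → Q) → (Q → P) → 𝟙 P? ≡ 𝟙 Q?
𝟙-cong P? Q? f g = ≤-antisym (𝟙-mono P? Q? f) (𝟙-mono Q? P? g)

sum-map-++ : (f : A → ℕ) (xs ys : List A) → sum (map f (xs ++ ys)) ≡ sum (map f xs) + sum (map f ys)
sum-map-++ f xs ys = trans (cong sum (map-++ f xs ys)) (sum-++ (map f xs) (map f ys))

sum-map-+ : (f g : A → ℕ) (xs : List A) → sum (map (λ x → f x + g x) xs) ≡ sum (map f xs) + sum (map g xs)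
sum-map-+ f g [] = refl
sum-map-+ f g (x ∷ xs) rewrite sum-map-+ f g xs = interchange (f x) (g x) (sum (map f xs)) (sum (map g xs))

sum-map-mono : {f g : A → ℕ} → (∀ x → f x ≤ g x) → (xs : List A) → sum (map f xs) ≤ sum (map g xs)
sum-map-mono f≤g [] = z≤n
sum-map-mono f≤g (x ∷ xs) = +-mono-≤ (f≤g x) (sum-map-mono f≤g xs)

sum-map-cong : {f g : A → ℕ} → (∀ x → f x ≡ g x) → (xs : List A) → sum (map f xs) ≡ sum (map g xs)
sum-map-cong f≡g xs = ≤-antisym (sum-map-mono (≤-reflexive ∘ f≡g) xs) (sum-map-mono (≤-reflexive ∘ sym ∘ f≡g) xs)

sum-map-zero : {f : A → ℕ} → (∀ x → f x ≡ 0) → (xs : List A) → sum (map f xs) ≡ 0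
sum-map-zero f≡0 [] = refl
sum-map-zero f≡0 (x ∷ xs) rewrite f≡0 x = sum-map-zero f≡0 xs

sum-map-≤-length : {f : A → ℕ} → (∀ x → f x ≤ 1) → (xs : List A) → sum (map f xs) ≤ length xs
sum-map-≤-length f≤1 [] = z≤n
sum-map-≤-length f≤1 (x ∷ xs) = +-mono-≤ (f≤1 x) (sum-map-≤-length f≤1 xs)

∈⇒≤sum-map : {f : A → ℕ} {x : A} {xs : List A} → x ∈ xs → f x ≤ sum (map f xs)
∈⇒≤sum-map (here refl) = m≤m+n _ _
∈⇒≤sum-map {f = f} {xs = y ∷ _} (there x∈xs) = ≤-trans (∈⇒≤sum-map x∈xs) (m≤n+m _ (f y))

sum-map-update : {f g : A → ℕ} {a : A} {xs : List A} → Unique xs → a ∈ xs →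
                 (∀ x → x ≢ a → f x ≡ g x) → sum (map f xs) + g a ≡ sum (map g xs) + f a
sum-map-update {f = f} {g} (a∉xs ∷ _) (here refl) f≡g
  rewrite map-cong-local (All.map (λ a≢x → f≡g _ (a≢x ∘ sym)) a∉xs) = swap-ends (f _) (g _) _
  where
  swap-ends : ∀ a b s → a + s + b ≡ b + s + a
  swap-ends = solve-∀
sum-map-update {f = f} {g} {a} {x ∷ xs} (x∉xs ∷ xs!) (there a∈xs) f≡g = begin
  f x + sum (map f xs) + g a    ≡⟨ +-assoc (f x) _ _ ⟩
  f x + (sum (map f xs) + g a)  ≡⟨ cong₂ _+_ (f≡g x (All.lookup x∉xs a∈xs)) (sum-map-update xs! a∈xs f≡g) ⟩
  g x + (sum (map g xs) + f a)  ≡⟨ sym (+-assoc (g x) _ _) ⟩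
  g x + sum (map g xs) + f a    ∎
  where open ≡-Reasoning

AllPairs-resp-⊆ : {R : A → A → Set} {xs ys : List A} → xs ⊆ ys → AllPairs R ys → AllPairs R xs
AllPairs-resp-⊆ Sublist.[]  []         = []
AllPairs-resp-⊆ (_ Sublist.∷ʳ xs⊆ys) (_ ∷ Rys)  = AllPairs-resp-⊆ xs⊆ys Rys
AllPairs-resp-⊆ (refl Sublist.∷ xs⊆ys) (Ry ∷ Rys) = All-resp-⊆ xs⊆ys Ry ∷ AllPairs-resp-⊆ xs⊆ys Rys

AllPairs-before : {R : A → A → Set} (xs : List A) {y : A} {ys : List A} →
                  AllPairs R (xs ++ y ∷ ys) → All (λ x → R x y) xs
AllPairs-before []       _           = []
AllPairs-before (x ∷ xs) (Rx ∷ Rxs) = All.head (All.++⁻ʳ xs Rx) ∷ AllPairs-before xs Rxs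

∷≢[] : {x : A} {xs : List A} → x ∷ xs ≢ []
∷≢[] ()

∷ʳ≢[] : (xs : List A) {x : A} → xs ++ [ x ] ≢ []
∷ʳ≢[] []      ()
∷ʳ≢[] (_ ∷ _) ()

length-<-++ : {xs ys : List A} → xs ≢ [] → length ys < length (xs ++ ys)
length-<-++ {xs = []}     xs≢[] = ⊥-elim (xs≢[] refl)
length-<-++ {xs = x ∷ xs} {ys} _ = s≤s (≤-trans (m≤n+m (length ys) (length xs)) (≤-reflexive (sym (length-++ xs))))

Fits : ℕ → ℕ → List ℕ → Set
Fits p d = Any (λ l → l + p ≤ d)

fits? : ∀ p d L → Dec (Fits p d L)
fits? p d = any? (λ l → l + p ≤? d)

ffInsert-++-Fits : ∀ {p d} T U → Fits p d T → ffInsert p d (T ++ U) ≡ ffInsert p d T ++ U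
ffInsert-++-Fits {p} {d} (l ∷ T) U fits with l + p ≤? d | fits
... | yes _     | _            = refl
... | no l+p≰d  | here l+p≤d   = contradiction l+p≤d l+p≰d
... | no _      | there fits′  = cong (l ∷_) (ffInsert-++-Fits T U fits′)

ffInsert-++-¬Fits : ∀ {p d} T U → ¬ Fits p d T → ffInsert p d (T ++ U) ≡ T ++ ffInsert p d U
ffInsert-++-¬Fits [] U _ = refl
ffInsert-++-¬Fits {p} {d} (l ∷ T) U ¬fits with l + p ≤? d
... | yes l+p≤d = contradiction (here l+p≤d) ¬fits
... | no _      = cong (l ∷_) (ffInsert-++-¬Fits T U (¬fits ∘ there))

length-ffInsert-Fits : ∀ {p d} L → Fits p d L → length (ffInsert p d L) ≡ length L
length-ffInsert-Fits {p} {d} (l ∷ L) fits with l + p ≤? d | fits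
... | yes _     | _           = refl
... | no l+p≰d  | here l+p≤d  = contradiction l+p≤d l+p≰d
... | no _      | there fits′ = cong suc (length-ffInsert-Fits L fits′)

sum-ffInsert : ∀ p d L → sum (ffInsert p d L) ≡ p + sum L
sum-ffInsert p d [] = refl
sum-ffInsert p d (l ∷ L) with l + p ≤? d
... | yes _ = trans (+-assoc l p (sum L)) (x∙yz≈y∙xz l p (sum L))
... | no _  = trans (cong (l +_) (sum-ffInsert p d L)) (x∙yz≈y∙xz l p (sum L))

ffInsert-≢[] : ∀ p d L → ffInsert p d L ≢ []
ffInsert-≢[] p d [] ()
ffInsert-≢[] p d (l ∷ L) with l + p ≤? d
... | yes _ = λ ()
... | no _  = λ ()

potential : List ℕ → ℕ
potential []           = 0
potential (l ∷ [])     = l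
potential (l ∷ l′ ∷ L) = 2 * l + potential (l′ ∷ L)

potential-∷ : ∀ l {L} → L ≢ [] → potential (l ∷ L) ≡ 2 * l + potential L
potential-∷ l {[]}    L≢[] = ⊥-elim (L≢[] refl)
potential-∷ l {_ ∷ _} _    = refl

potential≤2*sum : ∀ L → potential L ≤ 2 * sum L
potential≤2*sum []            = z≤n
potential≤2*sum (l ∷ [])      = ≤-trans (m≤m+n l 0) (m≤m+n (l + 0) _)
potential≤2*sum (l ∷ l′ ∷ L) = begin
  2 * l + potential (l′ ∷ L)    ≤⟨ +-monoʳ-≤ (2 * l) (potential≤2*sum (l′ ∷ L)) ⟩
  2 * l + 2 * sum (l′ ∷ L)      ≡⟨ sym (*-distribˡ-+ 2 l (sum (l′ ∷ L))) ⟩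
  2 * (l + sum (l′ ∷ L))        ∎
  where open ≤-Reasoning

data Insertion (d : ℕ) (L L′ : List ℕ) : Set where
  filled : length L′ ≡ length L → potential L ≤ potential L′ → Insertion d L L′
  opened : length L′ ≡ suc (length L) → potential L + suc d ≤ potential L′ → Insertion d L L′

insertion-∷ : ∀ {d L L′} l → L ≢ [] → L′ ≢ [] → Insertion d L L′ → Insertion d (l ∷ L) (l ∷ L′)
insertion-∷ {d} {L} {L′} l L≢[] L′≢[] (filled len pot) = filled (cong suc len) (begin
  potential (l ∷ L)       ≡⟨ potential-∷ l L≢[] ⟩
  2 * l + potential L     ≤⟨ +-monoʳ-≤ (2 * l) pot ⟩
  2 * l + potential L′    ≡⟨ sym (potential-∷ l L′≢[]) ⟩
  potential (l ∷ L′)      ∎)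
  where open ≤-Reasoning
insertion-∷ {d} {L} {L′} l L≢[] L′≢[] (opened len pot) = opened (cong suc len) (begin
  potential (l ∷ L) + suc d       ≡⟨ cong (_+ suc d) (potential-∷ l L≢[]) ⟩
  2 * l + potential L + suc d     ≡⟨ +-assoc (2 * l) _ _ ⟩
  2 * l + (potential L + suc d)   ≤⟨ +-monoʳ-≤ (2 * l) pot ⟩
  2 * l + potential L′            ≡⟨ sym (potential-∷ l L′≢[]) ⟩
  potential (l ∷ L′)              ∎)
  where open ≤-Reasoning

-- A machine is opened only when the job does not fit on the last one, whose load then starts
-- counting twice in the potential.
ffInsert-insertion : ∀ p d L → L ≢ [] → Insertion d L (ffInsert p d L)
ffInsert-insertion p d [] L≢[] = ⊥-elim (L≢[] refl)
ffInsert-insertion p d (l ∷ []) _ with l + p ≤? d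
... | yes _    = filled refl (m≤m+n l p)
... | no l+p≰d = opened refl (begin
  l + suc d        ≤⟨ +-monoʳ-≤ l (≰⇒> l+p≰d) ⟩
  l + (l + p)      ≡⟨ twice l p ⟩
  2 * l + p        ∎)
  where
  open ≤-Reasoning
  twice : ∀ l p → l + (l + p) ≡ 2 * l + p
  twice = solve-∀
ffInsert-insertion p d (l ∷ l′ ∷ L) _ = extend (ffInsert-insertion p d (l′ ∷ L) ∷≢[])
  where
  extend : Insertion d (l′ ∷ L) (ffInsert p d (l′ ∷ L)) → Insertion d (l ∷ l′ ∷ L) (ffInsert p d (l ∷ l′ ∷ L))
  extend tail with l + p ≤? d
  ... | yes _ = filled refl (+-monoˡ-≤ (potential (l′ ∷ L)) (*-monoʳ-≤ 2 (m≤m+n l p)))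
  ... | no _  = insertion-∷ l ∷≢[] (ffInsert-≢[] p d (l′ ∷ L)) tail

module FirstFit {J : Set} (p d : J → ℕ) where

  ffStep : List ℕ → J → List ℕ
  ffStep L j = ffInsert (p j) (d j) L

  firstFitFrom : List ℕ → List J → List ℕ
  firstFitFrom = foldl ffStep

  firstFit : List J → List ℕ
  firstFit = firstFitFrom []

  firstFit-∷ʳ : ∀ js j → firstFit (js ++ [ j ]) ≡ ffStep (firstFit js) j
  firstFit-∷ʳ js j = foldl-++ ffStep [] js [ j ]

  -- The jobs of js that first-fit, run from the machines T ++ U, does not place on a machine of T.
  overflow : List ℕ → List J → List J
  overflow T [] = []
  overflow T (j ∷ js) with fits? (p j) (d j) T
  ... | yes _ = overflow (ffStep T j) js
  ... | no _  = j ∷ overflow T js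

  overflow-⊆ : ∀ T js → overflow T js ⊆ js
  overflow-⊆ T [] = Sublist.[]
  overflow-⊆ T (j ∷ js) with fits? (p j) (d j) T
  ... | yes _ = j Sublist.∷ʳ overflow-⊆ (ffStep T j) js
  ... | no _  = refl Sublist.∷ overflow-⊆ T js

  length-firstFitFrom-++ : ∀ T U js →
    length (firstFitFrom (T ++ U) js) ≡ length T + length (firstFitFrom U (overflow T js))
  length-firstFitFrom-++ T U [] = length-++ T
  length-firstFitFrom-++ T U (j ∷ js) with fits? (p j) (d j) T
  ... | yes fits = begin
    length (firstFitFrom (ffStep (T ++ U) j) js)
      ≡⟨ cong (λ L → length (firstFitFrom L js)) (ffInsert-++-Fits T U fits) ⟩
    length (firstFitFrom (ffStep T j ++ U) js)
      ≡⟨ length-firstFitFrom-++ (ffStep T j) U js ⟩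
    length (ffStep T j) + length rest
      ≡⟨ cong (_+ length rest) (length-ffInsert-Fits T fits) ⟩
    length T + length rest
      ∎
    where
    open ≡-Reasoning
    rest : List ℕ
    rest = firstFitFrom U (overflow (ffStep T j) js)
  ... | no ¬fits = trans (cong (λ L → length (firstFitFrom L js)) (ffInsert-++-¬Fits T U ¬fits))
                         (length-firstFitFrom-++ T (ffStep U j) js)

  length-firstFit-++ : ∀ pre suf →
    length (firstFit (pre ++ suf)) ≡ length (firstFit pre) + length (firstFit (overflow (firstFit pre) suf))
  length-firstFit-++ pre suf = begin
    length (firstFit (pre ++ suf))                ≡⟨ cong length (foldl-++ ffStep [] pre suf) ⟩
    length (firstFitFrom (firstFit pre) suf)      ≡⟨ cong (λ T → length (firstFitFrom T suf)) (sym (++-identityʳ _)) ⟩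
    length (firstFitFrom (firstFit pre ++ []) suf) ≡⟨ length-firstFitFrom-++ (firstFit pre) [] suf ⟩
    length (firstFit pre) + length (firstFit (overflow (firstFit pre) suf)) ∎
    where open ≡-Reasoning

  sum-firstFitFrom : ∀ L js → sum (firstFitFrom L js) ≡ sum L + sum (map p js)
  sum-firstFitFrom L [] = sym (+-identityʳ (sum L))
  sum-firstFitFrom L (j ∷ js) = begin
    sum (firstFitFrom (ffStep L j) js)        ≡⟨ sum-firstFitFrom (ffStep L j) js ⟩
    sum (ffStep L j) + sum (map p js)         ≡⟨ cong (_+ sum (map p js)) (trans (sum-ffInsert (p j) (d j) L) (+-comm (p j) (sum L))) ⟩
    sum L + p j + sum (map p js)              ≡⟨ +-assoc (sum L) (p j) _ ⟩
    sum L + (p j + sum (map p js))            ∎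
    where open ≡-Reasoning

-- Invariant of the walk: first-fit has K machines and potential Y; the schedule σ has b
-- machines all of whose jobs are done, of total work F; D bounds the deadlines still to come.
-- Beyond 2F + 2b, the potential holds D + 1 for each of the c = K - 2b - 1 excess machines.
record Surplus (K b F Y D : ℕ) : Set where
  constructor mkSurplus
  field
    c       : ℕ
    count   : K ≡ 2 * b + suc c
    paid    : 2 * F + 2 * b + c * suc D ≤ Y

surplus-≢0 : ∀ {K b F Y D} → Surplus K b F Y D → K ≢ 0
surplus-≢0 {b = b} (mkSurplus c refl _) = m+1+n≢0 (2 * b)

surplus-lower : ∀ {K b F Y D D′} → D′ ≤ D → Surplus K b F Y D → Surplus K b F Y D′
surplus-lower {b = b} {F} D′≤D (mkSurplus c K≡ Y≥) =
  mkSurplus c K≡ (≤-trans (+-monoʳ-≤ (2 * F + 2 * b) (*-monoʳ-≤ c (s≤s D′≤D))) Y≥)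

surplus-insert : ∀ {L L′ b F D} → Insertion D L L′ →
                 Surplus (length L) b F (potential L) D → Surplus (length L′) b F (potential L′) D
surplus-insert (filled len pot) (mkSurplus c K≡ Y≥) = mkSurplus c (trans len K≡) (≤-trans Y≥ pot)
surplus-insert {L} {L′} {b} {F} {D} (opened len pot) (mkSurplus c K≡ Y≥) =
  mkSurplus (suc c) (trans len (trans (cong suc K≡) (sym (+-suc (2 * b) (suc c))))) (begin
    2 * F + 2 * b + suc c * suc D         ≡⟨ one-more (2 * F + 2 * b) c (suc D) ⟩
    2 * F + 2 * b + c * suc D + suc D     ≤⟨ +-monoˡ-≤ (suc D) Y≥ ⟩
    potential L + suc D                   ≤⟨ pot ⟩
    potential L′                          ∎)
  where
  open ≤-Reasoning
  one-more : ∀ X c D → X + suc c * D ≡ X + c * D + D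
  one-more = solve-∀

excess≥2 : ∀ b c → 2 * suc b < 2 * b + suc c → 2 ≤ c
excess≥2 b c more = ≤-pred (+-cancelˡ-≤ (2 * b) 3 (suc c) (subst (_≤ 2 * b + suc c) (three b) more))
  where
  three : ∀ b → suc (2 * suc b) ≡ 2 * b + 3
  three = solve-∀

-- A machine of σ closing with work cp ≤ D is paid for by two excess machines: 2(D + 1) ≥ 2cp + 2.
surplus-close : ∀ {K b F Y D cp} → cp ≤ D → 2 * suc b < K →
                Surplus K b F Y D → Surplus K (suc b) (F + cp) Y D
surplus-close {b = b} _ more (mkSurplus 0 refl _) with excess≥2 b 0 more
... | ()
surplus-close {b = b} _ more (mkSurplus 1 refl _) with excess≥2 b 1 more
... | s≤s ()
surplus-close {K} {b} {F} {Y} {D} {cp} cp≤D _ (mkSurplus (suc (suc c)) K≡ Y≥) =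
  mkSurplus c (trans K≡ (shift b c)) (begin
    2 * (F + cp) + 2 * suc b + c * suc D     ≡⟨ regroup F cp b (c * suc D) ⟩
    2 * F + 2 * b + c * suc D + 2 * suc cp   ≤⟨ +-monoʳ-≤ (2 * F + 2 * b + c * suc D) (*-monoʳ-≤ 2 (s≤s cp≤D)) ⟩
    2 * F + 2 * b + c * suc D + 2 * suc D    ≡⟨ two-more (2 * F + 2 * b) c (suc D) ⟩
    2 * F + 2 * b + suc (suc c) * suc D      ≤⟨ Y≥ ⟩
    Y                                        ∎)
  where
  open ≤-Reasoning
  shift : ∀ b c → 2 * b + suc (suc (suc c)) ≡ 2 * suc b + suc c
  shift = solve-∀
  regroup : ∀ F cp b X → 2 * (F + cp) + 2 * suc b + X ≡ 2 * F + 2 * b + X + 2 * suc cp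
  regroup = solve-∀
  two-more : ∀ X c D → X + c * D + 2 * D ≡ X + suc (suc c) * D
  two-more = solve-∀

surplus-exhausted : ∀ {K b F Y D} → Surplus K b F Y D → Y ≤ 2 * F → b ≡ 0
surplus-exhausted {b = b} {F} {Y} {D} (mkSurplus c _ Y≥) Y≤2F = n≤0⇒n≡0 (≤-trans (m≤m+n b (b + 0)) 2b≤0)
  where
  2b≤0 : 2 * b ≤ 0
  2b≤0 = +-cancelˡ-≤ (2 * F) (2 * b) 0 (begin
    2 * F + 2 * b                  ≤⟨ m≤m+n (2 * F + 2 * b) (c * suc D) ⟩
    2 * F + 2 * b + c * suc D      ≤⟨ Y≥ ⟩
    Y                              ≤⟨ Y≤2F ⟩
    2 * F                          ≡⟨ sym (+-identityʳ (2 * F)) ⟩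
    2 * F + 0                      ∎)
    where open ≤-Reasoning

module Charging {J : Set} (p d σ : J → ℕ) where

  open FirstFit p d

  NonIncreasing : List J → Set
  NonIncreasing = AllPairs (λ i j → d j ≤ d i)

  load : ℕ → List J → ℕ
  load ℓ js = sum (map p (filter (λ j → σ j ≟ ℓ) js))

  load-++ : ∀ ℓ xs ys → load ℓ (xs ++ ys) ≡ load ℓ xs + load ℓ ys
  load-++ ℓ xs ys = trans (cong (sum ∘ map p) (filter-++ (λ j → σ j ≟ ℓ) xs ys))
                          (sum-map-++ p (filter (λ j → σ j ≟ ℓ) xs) (filter (λ j → σ j ≟ ℓ) ys))

  load-[j] : ∀ j → load (σ j) [ j ] ≡ p j
  load-[j] j rewrite filter-accept (λ k → σ k ≟ σ j) {xs = []} (refl {x = σ j}) = +-identityʳ (p j)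

  load-[j]-≢ : ∀ {ℓ} j → σ j ≢ ℓ → load ℓ [ j ] ≡ 0
  load-[j]-≢ {ℓ} j σj≢ℓ rewrite filter-reject (λ k → σ k ≟ ℓ) {xs = []} σj≢ℓ = refl

  load-mono : ∀ ℓ {xs ys} → xs ⊆ ys → load ℓ xs ≤ load ℓ ys
  load-mono ℓ Sublist.[] = z≤n
  load-mono ℓ {xs} {y ∷ ys} (_ Sublist.∷ʳ xs⊆ys) = begin
    load ℓ xs                 ≤⟨ load-mono ℓ xs⊆ys ⟩
    load ℓ ys                 ≤⟨ m≤n+m (load ℓ ys) (load ℓ [ y ]) ⟩
    load ℓ [ y ] + load ℓ ys  ≡⟨ sym (load-++ ℓ [ y ] ys) ⟩
    load ℓ (y ∷ ys)           ∎
    where open ≤-Reasoning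
  load-mono ℓ {x ∷ _} (refl Sublist.∷ xs⊆ys) =
    subst₂ _≤_ (sym (load-++ ℓ [ x ] _)) (sym (load-++ ℓ [ x ] _)) (+-monoʳ-≤ (load ℓ [ x ]) (load-mono ℓ xs⊆ys))

  -- OnTime done js: every job of js meets its deadline when its machine first processes the
  -- jobs of done and then the earlier jobs of js.
  OnTime : List J → List J → Set
  OnTime done []       = ⊤
  OnTime done (j ∷ js) = load (σ j) done + p j ≤ d j × OnTime (done ++ [ j ]) js

  OnTime-⊆ : ∀ {done′ done js′ js} → done′ ⊆ done → js′ ⊆ js → OnTime done js → OnTime done′ js′
  OnTime-⊆ _ Sublist.[] _ = tt
  OnTime-⊆ done′⊆done (j Sublist.∷ʳ js′⊆js) (_ , onTime) = OnTime-⊆ (++⁺ʳ [ j ] done′⊆done) js′⊆js onTime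
  OnTime-⊆ {js′ = j ∷ _} done′⊆done (refl Sublist.∷ js′⊆js) (j-on-time , onTime) =
    ≤-trans (+-monoˡ-≤ (p j) (load-mono (σ j) done′⊆done)) j-on-time ,
    OnTime-⊆ (++⁺ done′⊆done ⊆-refl) js′⊆js onTime

  Uses : List J → ℕ → Set
  Uses js ℓ = Any (λ j → σ j ≡ ℓ) js

  uses? : ∀ js ℓ → Dec (Uses js ℓ)
  uses? js ℓ = any? (λ j → σ j ≟ ℓ) js

  Uses-∷ʳ-≢ : ∀ {ℓ} pre {x} → ℓ ≢ σ x → Uses (pre ++ [ x ]) ℓ → Uses pre ℓ
  Uses-∷ʳ-≢ pre ℓ≢σx u with Any.++⁻ pre u
  ... | inj₁ u-pre           = u-pre
  ... | inj₂ (here σx≡ℓ)     = contradiction (sym σx≡ℓ) ℓ≢σx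

  module Counting {U : List ℕ} (U! : Unique U) (σ∈U : ∀ j → σ j ∈ U) where

    used : List J → ℕ
    used js = sum (map (λ ℓ → 𝟙 (uses? js ℓ)) U)

    closedSum : (ℕ → List J → ℕ) → List J → List J → ℕ
    closedSum m pre suf = sum (map (λ ℓ → 𝟙 (¬? (uses? suf ℓ)) * m ℓ pre) U)

    closed : List J → List J → ℕ
    closed = closedSum (λ ℓ pre → 𝟙 (uses? pre ℓ))

    closedLoad : List J → List J → ℕ
    closedLoad = closedSum load

    used-++ : ∀ pre suf → used (pre ++ suf) ≡ closed pre suf + used suf
    used-++ pre suf = trans (sum-map-cong split-at U) (sum-map-+ _ _ U)
      where
      split-at : ∀ ℓ → 𝟙 (uses? (pre ++ suf) ℓ) ≡ 𝟙 (¬? (uses? suf ℓ)) * 𝟙 (uses? pre ℓ) + 𝟙 (uses? suf ℓ)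
      split-at ℓ with uses? suf ℓ
      ... | yes u = 𝟙-yes (uses? (pre ++ suf) ℓ) (Any.++⁺ʳ pre u)
      ... | no ¬u = trans (𝟙-cong (uses? (pre ++ suf) ℓ) (uses? pre ℓ) in-pre Any.++⁺ˡ)
                          (sym (trans (+-identityʳ _) (*-identityˡ _)))
        where
        in-pre : Uses (pre ++ suf) ℓ → Uses pre ℓ
        in-pre u with Any.++⁻ pre u
        ... | inj₁ u-pre = u-pre
        ... | inj₂ u-suf = contradiction u-suf ¬u

    used-mono : ∀ {xs ys} → xs ⊆ ys → used xs ≤ used ys
    used-mono xs⊆ys = sum-map-mono (λ ℓ → 𝟙-mono (uses? _ ℓ) (uses? _ ℓ) (Any-resp-⊆ xs⊆ys)) U

    closed-[]-pos : ∀ j js → 1 ≤ closed (j ∷ js) []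
    closed-[]-pos j js = subst (_≤ closed (j ∷ js) []) (cong (1 *_) (𝟙-yes (uses? (j ∷ js) (σ j)) (here refl)))
                               (∈⇒≤sum-map (σ∈U j))

    sum-load : ∀ js → sum (map (λ ℓ → load ℓ js) U) ≡ sum (map p js)
    sum-load [] = sum-map-zero (λ _ → refl) U
    sum-load (j ∷ js) = begin
      sum (map (λ ℓ → load ℓ (j ∷ js)) U)   ≡⟨ +-cancelʳ-≡ (load (σ j) js) _ _ moved ⟩
      p j + sum (map (λ ℓ → load ℓ js) U)   ≡⟨ cong (p j +_) (sum-load js) ⟩
      p j + sum (map p js)                  ∎
      where
      open ≡-Reasoning
      elsewhere : ∀ ℓ → ℓ ≢ σ j → load ℓ (j ∷ js) ≡ load ℓ js
      elsewhere ℓ ℓ≢σj = trans (load-++ ℓ [ j ] js) (cong (_+ load ℓ js) (load-[j]-≢ j (ℓ≢σj ∘ sym)))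
      total : ℕ
      total = sum (map (λ ℓ → load ℓ js) U)
      moved : sum (map (λ ℓ → load ℓ (j ∷ js)) U) + load (σ j) js ≡ p j + sum (map (λ ℓ → load ℓ js) U) + load (σ j) js
      moved = trans (sum-map-update U! (σ∈U j) elsewhere)
                    (trans (cong (total +_) (trans (load-++ (σ j) [ j ] js) (cong (_+ load (σ j) js) (load-[j] j))))
                           (trans (sym (+-assoc total (p j) (load (σ j) js))) (cong (_+ load (σ j) js) (+-comm total (p j)))))

    closedLoad-[] : ∀ js → closedLoad js [] ≡ sum (map p js)
    closedLoad-[] js = trans (sum-map-cong (λ ℓ → *-identityˡ (load ℓ js)) U) (sum-load js)

    closedSum-[] : ∀ m suf → (∀ ℓ → m ℓ [] ≡ 0) → closedSum m [] suf ≡ 0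
    closedSum-[] m suf m≡0 = sum-map-zero (λ ℓ → trans (cong (𝟙 (¬? (uses? suf ℓ)) *_) (m≡0 ℓ)) (*-zeroʳ (𝟙 (¬? (uses? suf ℓ))))) U

    closedSum-∷ʳ : ∀ m pre x suf → (∀ ℓ → ℓ ≢ σ x → m ℓ (pre ++ [ x ]) ≡ m ℓ pre) →
      closedSum m (pre ++ [ x ]) suf ≡ closedSum m pre (x ∷ suf) + 𝟙 (¬? (uses? suf (σ x))) * m (σ x) (pre ++ [ x ])
    closedSum-∷ʳ m pre x suf elsewhere = begin
      closedSum m (pre ++ [ x ]) suf                                   ≡⟨ sym (+-identityʳ _) ⟩
      closedSum m (pre ++ [ x ]) suf + 0                               ≡⟨ cong (closedSum m (pre ++ [ x ]) suf +_) (sym now-open) ⟩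
      closedSum m (pre ++ [ x ]) suf + 𝟙 (¬? (uses? (x ∷ suf) (σ x))) * m (σ x) pre
                                                                       ≡⟨ sum-map-update U! (σ∈U x) same ⟩
      closedSum m pre (x ∷ suf) + 𝟙 (¬? (uses? suf (σ x))) * m (σ x) (pre ++ [ x ]) ∎
      where
      open ≡-Reasoning
      now-open : 𝟙 (¬? (uses? (x ∷ suf) (σ x))) * m (σ x) pre ≡ 0
      now-open = cong (_* m (σ x) pre) (𝟙-no (¬? (uses? (x ∷ suf) (σ x))) (λ ¬u → ¬u (here refl)))
      same : ∀ ℓ → ℓ ≢ σ x → 𝟙 (¬? (uses? suf ℓ)) * m ℓ (pre ++ [ x ]) ≡ 𝟙 (¬? (uses? (x ∷ suf) ℓ)) * m ℓ pre
      same ℓ ℓ≢σx = cong₂ _*_ (𝟙-cong (¬? (uses? suf ℓ)) (¬? (uses? (x ∷ suf) ℓ)) (λ ¬u u → ¬u (in-suf u)) (λ ¬u u → ¬u (there u)))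
                              (elsewhere ℓ ℓ≢σx)
        where
        in-suf : Uses (x ∷ suf) ℓ → Uses suf ℓ
        in-suf (here σx≡ℓ) = contradiction (sym σx≡ℓ) ℓ≢σx
        in-suf (there u)   = u

    closedSum-∷ʳ-open : ∀ m pre x suf → (∀ ℓ → ℓ ≢ σ x → m ℓ (pre ++ [ x ]) ≡ m ℓ pre) → Uses suf (σ x) →
      closedSum m (pre ++ [ x ]) suf ≡ closedSum m pre (x ∷ suf)
    closedSum-∷ʳ-open m pre x suf elsewhere u = begin
      closedSum m (pre ++ [ x ]) suf                                       ≡⟨ closedSum-∷ʳ m pre x suf elsewhere ⟩
      closedSum m pre (x ∷ suf) + 𝟙 (¬? (uses? suf (σ x))) * m (σ x) (pre ++ [ x ])
                                    ≡⟨ cong (λ k → closedSum m pre (x ∷ suf) + k * _) (𝟙-no (¬? (uses? suf (σ x))) (λ ¬u → ¬u u)) ⟩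
      closedSum m pre (x ∷ suf) + 0                                        ≡⟨ +-identityʳ _ ⟩
      closedSum m pre (x ∷ suf)                                            ∎
      where open ≡-Reasoning

    closedSum-∷ʳ-close : ∀ m pre x suf → (∀ ℓ → ℓ ≢ σ x → m ℓ (pre ++ [ x ]) ≡ m ℓ pre) → ¬ Uses suf (σ x) →
      closedSum m (pre ++ [ x ]) suf ≡ closedSum m pre (x ∷ suf) + m (σ x) (pre ++ [ x ])
    closedSum-∷ʳ-close m pre x suf elsewhere ¬u = begin
      closedSum m (pre ++ [ x ]) suf                                       ≡⟨ closedSum-∷ʳ m pre x suf elsewhere ⟩
      closedSum m pre (x ∷ suf) + 𝟙 (¬? (uses? suf (σ x))) * m (σ x) (pre ++ [ x ])
                                    ≡⟨ cong (λ k → closedSum m pre (x ∷ suf) + k * _) (𝟙-yes (¬? (uses? suf (σ x))) ¬u) ⟩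
      closedSum m pre (x ∷ suf) + 1 * m (σ x) (pre ++ [ x ])               ≡⟨ cong (closedSum m pre (x ∷ suf) +_) (*-identityˡ _) ⟩
      closedSum m pre (x ∷ suf) + m (σ x) (pre ++ [ x ])                   ∎
      where open ≡-Reasoning

    uses-elsewhere : ∀ pre x ℓ → ℓ ≢ σ x → 𝟙 (uses? (pre ++ [ x ]) ℓ) ≡ 𝟙 (uses? pre ℓ)
    uses-elsewhere pre x ℓ ℓ≢σx = 𝟙-cong (uses? (pre ++ [ x ]) ℓ) (uses? pre ℓ) (Uses-∷ʳ-≢ pre ℓ≢σx) Any.++⁺ˡ

    load-elsewhere : ∀ pre x ℓ → ℓ ≢ σ x → load ℓ (pre ++ [ x ]) ≡ load ℓ pre
    load-elsewhere pre x ℓ ℓ≢σx =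
      trans (load-++ ℓ pre [ x ]) (trans (cong (load ℓ pre +_) (load-[j]-≢ x (ℓ≢σx ∘ sym))) (+-identityʳ _))

    closed-∷ʳ-open : ∀ pre x suf → Uses suf (σ x) → closed (pre ++ [ x ]) suf ≡ closed pre (x ∷ suf)
    closed-∷ʳ-open pre x suf = closedSum-∷ʳ-open (λ ℓ pre → 𝟙 (uses? pre ℓ)) pre x suf (uses-elsewhere pre x)

    closed-∷ʳ-close : ∀ pre x suf → ¬ Uses suf (σ x) → closed (pre ++ [ x ]) suf ≡ suc (closed pre (x ∷ suf))
    closed-∷ʳ-close pre x suf ¬u = begin
      closed (pre ++ [ x ]) suf
        ≡⟨ closedSum-∷ʳ-close (λ ℓ pre → 𝟙 (uses? pre ℓ)) pre x suf (uses-elsewhere pre x) ¬u ⟩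
      closed pre (x ∷ suf) + 𝟙 (uses? (pre ++ [ x ]) (σ x))
        ≡⟨ cong (closed pre (x ∷ suf) +_) (𝟙-yes (uses? (pre ++ [ x ]) (σ x)) (Any.++⁺ʳ pre (here refl))) ⟩
      closed pre (x ∷ suf) + 1
        ≡⟨ +-comm (closed pre (x ∷ suf)) 1 ⟩
      suc (closed pre (x ∷ suf))
        ∎
      where open ≡-Reasoning

    closedLoad-∷ʳ-open : ∀ pre x suf → Uses suf (σ x) → closedLoad (pre ++ [ x ]) suf ≡ closedLoad pre (x ∷ suf)
    closedLoad-∷ʳ-open pre x suf = closedSum-∷ʳ-open load pre x suf (load-elsewhere pre x)

    closedLoad-∷ʳ-close : ∀ pre x suf → ¬ Uses suf (σ x) →
      closedLoad (pre ++ [ x ]) suf ≡ closedLoad pre (x ∷ suf) + (load (σ x) pre + p x)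
    closedLoad-∷ʳ-close pre x suf ¬u =
      trans (closedSum-∷ʳ-close load pre x suf (load-elsewhere pre x) ¬u)
            (cong (closedLoad pre (x ∷ suf) +_)
                  (trans (load-++ (σ x) pre [ x ]) (cong (load (σ x) pre +_) (load-[j] x))))

    record Walking (pre suf : List J) : Set where
      field
        bound         : ℕ
        suf≤bound     : All (λ j → d j ≤ bound) suf
        surplus       : Surplus (length (firstFit pre)) (closed pre suf) (closedLoad pre suf)
                                (potential (firstFit pre)) bound
        onTime        : OnTime pre suf
        nonIncreasing : NonIncreasing suf

    record BalancedSplit (js : List J) : Set where
      constructor split
      field
        pre suf       : List J
        pre++suf≡js   : pre ++ suf ≡ js
        pre≢[]        : pre ≢ []
        balanced      : length (firstFit pre) ≤ 2 * closed pre suf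
        onTime        : OnTime pre suf
        nonIncreasing : NonIncreasing suf

    -- Once every machine is closed, the potential is at most twice the closed work.
    ¬Walking-[] : ∀ pre → ¬ Walking pre []
    ¬Walking-[] [] w = surplus-≢0 (Walking.surplus w) refl
    ¬Walking-[] (j ∷ js) w with subst (1 ≤_) (surplus-exhausted (Walking.surplus w) potential≤2F) (closed-[]-pos j js)
      where
      potential≤2F : potential (firstFit (j ∷ js)) ≤ 2 * closedLoad (j ∷ js) []
      potential≤2F = ≤-trans (potential≤2*sum (firstFit (j ∷ js)))
                             (≤-reflexive (cong (2 *_) (trans (sum-firstFitFrom [] (j ∷ js)) (sym (closedLoad-[] (j ∷ js))))))
    ... | ()

    advance : ∀ {pre x suf} → Walking pre (x ∷ suf) →
              2 * closed (pre ++ [ x ]) suf < length (firstFit (pre ++ [ x ])) → Walking (pre ++ [ x ]) suf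
    advance {pre} {x} {suf} w unbalanced = record
      { bound         = d x
      ; suf≤bound     = AllPairs.head nonIncreasing
      ; surplus       = surplus′
      ; onTime        = proj₂ onTime
      ; nonIncreasing = AllPairs.tail nonIncreasing
      }
      where
      open Walking w
      K′ Y′ : ℕ
      K′ = length (firstFit (pre ++ [ x ]))
      Y′ = potential (firstFit (pre ++ [ x ]))
      grown : Surplus K′ (closed pre (x ∷ suf)) (closedLoad pre (x ∷ suf)) Y′ (d x)
      grown rewrite firstFit-∷ʳ pre x =
        surplus-insert {b = closed pre (x ∷ suf)} {F = closedLoad pre (x ∷ suf)}
          (ffInsert-insertion (p x) (d x) (firstFit pre) (surplus-≢0 surplus ∘ cong length))
          (surplus-lower (All.head suf≤bound) surplus)
      surplus′ : Surplus K′ (closed (pre ++ [ x ]) suf) (closedLoad (pre ++ [ x ]) suf) Y′ (d x)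
      surplus′ with uses? suf (σ x)
      ... | yes u = subst₂ (λ b F → Surplus K′ b F Y′ (d x))
                           (sym (closed-∷ʳ-open pre x suf u)) (sym (closedLoad-∷ʳ-open pre x suf u)) grown
      ... | no ¬u = subst₂ (λ b F → Surplus K′ b F Y′ (d x))
                           (sym (closed-∷ʳ-close pre x suf ¬u)) (sym (closedLoad-∷ʳ-close pre x suf ¬u))
                           (surplus-close {b = closed pre (x ∷ suf)} {F = closedLoad pre (x ∷ suf)} (proj₁ onTime)
                              (subst (λ b → 2 * b < K′) (closed-∷ʳ-close pre x suf ¬u) unbalanced) grown)

    walk : ∀ pre suf → Walking pre suf → BalancedSplit (pre ++ suf)
    walk pre []        w = ⊥-elim (¬Walking-[] pre w)
    walk pre (x ∷ suf) w with length (firstFit (pre ++ [ x ])) ≤? 2 * closed (pre ++ [ x ]) suf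
    ... | yes balanced  = split (pre ++ [ x ]) suf (++-assoc pre [ x ] suf) (∷ʳ≢[] pre) balanced
                                (proj₂ (Walking.onTime w)) (AllPairs.tail (Walking.nonIncreasing w))
    ... | no unbalanced = subst BalancedSplit (++-assoc pre [ x ] suf)
                                (walk (pre ++ [ x ]) suf (advance w (≰⇒> unbalanced)))

    balancedSplit : ∀ x suf → NonIncreasing (x ∷ suf) → OnTime [] (x ∷ suf) → BalancedSplit (x ∷ suf)
    balancedSplit x suf (x≥suf ∷ nonIncreasing) (_ , onTime) with uses? suf (σ x)
    ... | no ¬u = split [ x ] suf refl ∷≢[] (subst (λ b → 1 ≤ 2 * b) (sym (closed-∷ʳ-close [] x suf ¬u)) (s≤s z≤n))
                        onTime nonIncreasing
    ... | yes u = walk [ x ] suf (record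
      { bound         = d x
      ; suf≤bound     = x≥suf
      ; surplus       = subst₂ (λ b F → Surplus 1 b F (p x) (d x)) (sym no-closed) (sym no-closedLoad) (mkSurplus 0 refl z≤n)
      ; onTime        = onTime
      ; nonIncreasing = nonIncreasing
      })
      where
      no-closed : closed [ x ] suf ≡ 0
      no-closed = trans (closed-∷ʳ-open [] x suf u) (closedSum-[] (λ ℓ pre → 𝟙 (uses? pre ℓ)) (x ∷ suf) (λ _ → refl))
      no-closedLoad : closedLoad [ x ] suf ≡ 0
      no-closedLoad = trans (closedLoad-∷ʳ-open [] x suf u) (closedSum-[] load (x ∷ suf) (λ _ → refl))

    firstFit≤2*used : ∀ js → NonIncreasing js → OnTime [] js → length (firstFit js) ≤ 2 * used js
    firstFit≤2*used js = go js (On.wellFounded length <-wellFounded js)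
      where
      go : ∀ js → Acc (_<_ on length) js → NonIncreasing js → OnTime [] js → length (firstFit js) ≤ 2 * used js
      go []       _            _    _      = z≤n
      go (x ∷ xs) (acc smaller) nonInc onTime₀ with balancedSplit x xs nonInc onTime₀
      ... | split pre suf pre++suf≡js pre≢[] balanced onTime nonIncreasing =
        subst (λ js → length (firstFit js) ≤ 2 * used js) pre++suf≡js (begin
          length (firstFit (pre ++ suf))                  ≡⟨ length-firstFit-++ pre suf ⟩
          length (firstFit pre) + length (firstFit rest)  ≤⟨ +-mono-≤ balanced rest-bound ⟩
          2 * closed pre suf + 2 * used rest              ≤⟨ +-monoʳ-≤ (2 * closed pre suf) (*-monoʳ-≤ 2 (used-mono rest⊆suf)) ⟩
          2 * closed pre suf + 2 * used suf               ≡⟨ sym (*-distribˡ-+ 2 (closed pre suf) (used suf)) ⟩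
          2 * (closed pre suf + used suf)                 ≡⟨ cong (2 *_) (sym (used-++ pre suf)) ⟩
          2 * used (pre ++ suf)                           ∎)
        where
        open ≤-Reasoning
        rest : List J
        rest = overflow (firstFit pre) suf
        rest⊆suf : rest ⊆ suf
        rest⊆suf = overflow-⊆ (firstFit pre) suf
        rest-bound : length (firstFit rest) ≤ 2 * used rest
        rest-bound = go rest (smaller (≤-trans (s≤s (length-mono-≤ rest⊆suf))
                                               (≤-trans (length-<-++ pre≢[]) (≤-reflexive (cong length pre++suf≡js)))))
                        (AllPairs-resp-⊆ rest⊆suf nonIncreasing) (OnTime-⊆ (minimum pre) rest⊆suf onTime)

module _ {n : ℕ} (p d σ : Fin n → ℕ) where

  open Charging p d σ

  upTo? : (x k : Fin n) → Dec (toℕ k ≤ toℕ x × σ k ≡ σ x)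
  upTo? x k = (toℕ k ≤? toℕ x) ×-dec (σ k ≟ σ x)

  filter-earlier : ∀ {x} ys → All (λ y → toℕ y < toℕ x) ys →
    filter (λ y → σ y ≟ σ x) ys ≡ filter (upTo? x) ys
  filter-earlier [] [] = refl
  filter-earlier {x} (y ∷ ys) (y<x ∷ ys<x) with σ y ≟ σ x
  ... | yes σy≡σx = begin
    filter (λ y → σ y ≟ σ x) (y ∷ ys)  ≡⟨ filter-accept (λ y → σ y ≟ σ x) σy≡σx ⟩
    y ∷ filter (λ y → σ y ≟ σ x) ys    ≡⟨ cong (y ∷_) (filter-earlier ys ys<x) ⟩
    y ∷ filter (upTo? x) ys            ≡⟨ sym (filter-accept (upTo? x) (<⇒≤ y<x , σy≡σx)) ⟩
    filter (upTo? x) (y ∷ ys)          ∎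
    where open ≡-Reasoning
  ... | no σy≢σx = begin
    filter (λ y → σ y ≟ σ x) (y ∷ ys)  ≡⟨ filter-reject (λ y → σ y ≟ σ x) σy≢σx ⟩
    filter (λ y → σ y ≟ σ x) ys        ≡⟨ filter-earlier ys ys<x ⟩
    filter (upTo? x) ys                ≡⟨ sym (filter-reject (upTo? x) (σy≢σx ∘ proj₂)) ⟩
    filter (upTo? x) (y ∷ ys)          ∎
    where open ≡-Reasoning

  load+p≤completion : ∀ done x js → done ++ x ∷ js ≡ allFin n → load (σ x) done + p x ≤ completion p σ x
  load+p≤completion done x js done++x∷js≡jobs = begin
    load (σ x) done + p x                          ≡⟨ cong (_+ p x) (cong (sum ∘ map p) (filter-earlier done done<x)) ⟩
    Σdone + p x                                    ≤⟨ +-monoʳ-≤ Σdone (m≤m+n (p x) _) ⟩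
    Σdone + sum (map p (x ∷ filter (upTo? x) js))  ≡⟨ cong (λ ks → Σdone + sum (map p ks)) (sym (filter-accept (upTo? x) (≤-refl , refl))) ⟩
    Σdone + sum (map p (filter (upTo? x) (x ∷ js)))  ≡⟨ sym (sum-map-++ p (filter (upTo? x) done) _) ⟩
    sum (map p (filter (upTo? x) done ++ filter (upTo? x) (x ∷ js)))  ≡⟨ cong (sum ∘ map p) (sym (filter-++ (upTo? x) done (x ∷ js))) ⟩
    sum (map p (filter (upTo? x) (done ++ x ∷ js)))                   ≡⟨ cong (sum ∘ map p ∘ filter (upTo? x)) done++x∷js≡jobs ⟩
    completion p σ x                                                  ∎
    where
    open ≤-Reasoning
    Σdone : ℕ
    Σdone = sum (map p (filter (upTo? x) done))
    done<x : All (λ y → toℕ y < toℕ x) done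
    done<x = AllPairs-before done (subst (AllPairs _) (sym done++x∷js≡jobs) (AllPairsₚ.tabulate⁺-< (λ i<j → i<j)))

  onTime-allFin : Feasible p d σ → ∀ done js → done ++ js ≡ allFin n → OnTime done js
  onTime-allFin feasible done []       _           = tt
  onTime-allFin feasible done (x ∷ js) done++js≡jobs =
    ≤-trans (load+p≤completion done x js done++js≡jobs) (feasible x) ,
    onTime-allFin feasible (done ++ [ x ]) js (trans (++-assoc done [ x ] js) done++js≡jobs)

  nonIncreasing-allFin : (∀ i j → i ≤ᶠ j → d j ≤ d i) → NonIncreasing (allFin n)
  nonIncreasing-allFin antitone = AllPairsₚ.tabulate⁺-< (λ {i} {j} i<j → antitone i j (<⇒≤ i<j))

theorem4 : (n : ℕ) (p d : Fin n → ℕ) →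
    (∀ j → 0 < p j) →
    (∀ j → p j ≤ d j) →
    (∀ i j → i ≤ᶠ j → d j ≤ d i) →
    (σ : Schedule n) → Feasible p d σ →
    FF p d ≤ 2 * machinesUsed σ
theorem4 n p d _ _ antitone σ feasible = begin
  FF p d                ≤⟨ firstFit≤2*used (allFin n) (nonIncreasing-allFin p d σ antitone)
                                           (onTime-allFin p d σ feasible [] (allFin n) refl) ⟩
  2 * used (allFin n)   ≤⟨ *-monoʳ-≤ 2 (sum-map-≤-length (λ ℓ → 𝟙≤1 (uses? (allFin n) ℓ)) machines) ⟩
  2 * machinesUsed σ    ∎
  where
  open ≤-Reasoning
  open Charging p d σ
  machines : List ℕ
  machines = deduplicate _≟_ (map σ (allFin n))
  open Counting (deduplicate-! (map σ (allFin n))) (λ j → ∈-deduplicate⁺ _≟_ (∈-map⁺ σ (∈-allFin j)))
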